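{- Let $\langle V,O,\mathrm{label},\mathrm{or},<,U,S\rangle$ be a proof net for some sequent, with set of leaves $W$. Let $a\in U$ be such that there is no $b\in U\cap W$ with $b\,O^*\,a$. Then there exists $c\in V$ with $O(c)=a$ and $\mathrm{or}(c,a)=2$.
   Context: Types are built from primitive types $p_1,p_2,\dots$ using the binary connective $\backslash$ and the unary connective $!$. A sequent has the form $\Gamma\to A$ with $\Gamma$ a finite, possibly empty, sequence of types and $A$ a type. Tree of a type. To each type $T$ associate a rooted tree $\langle V,O\rangle$ (arcs directed towards the root; $O$ is also viewed as the parent function on non-root vertices, so $O(c)=a$ means $a$ is the parent of $c$), its set of leaves $W$, a labelling $\mathrm{label}:W\to\{p_1,p_2,\dots\}$, an arc labelling $\mathrm{or}:O\to\{ -1,1,2\}$ and a strict linear order $<$ on $V$, inductively: for a primitive type $p$, a single vertex labelled $p$; for $!A$, take the structure of $A$, add a new root and an arc labelled $2$ from the root of $A$ to the new root, and order so that the new root is the least element, the rest ordered as for $A$; for $A\backslash B$, take the disjoint union of the structures for $A$ and $B$, add a new root, an arc labelled $-1$ from the root of $A$ and an arc labelled $1$ from the root of $B$ to the new root, and order $V$ as: the reversed order of the $A$-part, then the new root, then the order of the $B$-part. The structure of a sequent $A_1\dots A_n\to B$ is that of the type $A_n\backslash(A_{n-1}\backslash\cdots\backslash(A_1\backslash B)\cdots)$ (that of $B$ if $n=0$). Notation: $d(a)$ is the number of arcs labelled $-1$ on the path from $a$ to the root; $H(a)$ is the unique leaf from which a path to $a$ contains no arc labelled $-1$; $O^*$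 is the reflexive–transitive closure of $O$; $\mathrm{pr}_1(S)=\{a\mid\exists b\,(a,b)\in S\}$; when $S$ is functional, $S(a)$ denotes the unique $b$ with $(a,b)\in S$. Proof net. A proof net for a sequent is its structure $\langle V,O,\mathrm{label},\mathrm{or},<\rangle$ together with a set $U\subseteq V$ and a relation $S\subseteq W\times W$ such that: PN1: $(a,b)\in S\Rightarrow(b,a)\in S$; PN2: $(a,b)\in S$ and $(a,c)\in S$ imply $b=c$; PN3: if $(a,b)\in S$, $(c,d)\in S$ and $a<c<b$, then $a<d<b$; PN4: $(a,b)\in S\Rightarrow \mathrm{label}(a)=\mathrm{label}(b)$; PN5: if $(a,b)\in S$ and $a<b$, then $d(a)=d(b)+1$; PN6: if $a\,O^*\,c$, $H(c)=b$, $a\in\mathrm{pr}_1(S)$, $S(b)$ is defined and $a<S(b)<b$, then there is $d$ with $S(a)\,O^*\,d$ and $H(d)=b$; PN7: $S\neq\emptyset$; PN8: $\mathrm{pr}_1(S)=W\cap U$; PN9: if $a\,O\,b$ and $b\notin U$, then $a\notin U$; PN10: if $a\,O\,b$, $a\notin U$ and $\mathrm{or}(a,b)\neq 2$, then $b\notin U$; PN11: if $a\,O\,b$ and $d(b)$ is even, then $\mathrm{or}(a,b)\neq 2$. -}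

module Defs where

open import Data.Nat using (ℕ; zero; suc; _%_)
open import Data.List using (List; []; _∷_)
open import Data.Maybe using (Maybe; just; nothing)
open import Data.Product using (Σ; ∃; _×_; _,_)
open import Relation.Nullary using (¬_)
open import Relation.Binary.PropositionalEquality using (_≡_)
open import Relation.Binary.Construct.Closure.ReflexiveTransitive using (Star)

infixr 5 _∖_
data Ty : Set where
  prim : ℕ → Ty
  _∖_  : Ty → Ty → Ty
  !_   : Ty → Ty

-- Type of the sequent A₁ … Aₙ → B, namely Aₙ∖(Aₙ₋₁∖⋯∖(A₁∖B)⋯).
-- The list is given in the order A₁ … Aₙ.
seqTy : List Ty → Ty → Ty
seqTy []       B = B
seqTy (A ∷ Γ)  B = seqTy Γ (A ∖ B)

-- Vertices of the tree of a type: positions (subterm occurrences).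
data Pos : Ty → Set where
  here  : ∀ {T} → Pos T
  inL   : ∀ {A B} → Pos A → Pos (A ∖ B)
  inR   : ∀ {A B} → Pos B → Pos (A ∖ B)
  inBng : ∀ {A} → Pos A → Pos (! A)

sub : ∀ {T} → Pos T → Ty
sub {T} here = T
sub (inL p)   = sub p
sub (inR p)   = sub p
sub (inBng p) = sub p

Leaf : ∀ {T} → Pos T → Set
Leaf p = ∃ λ n → sub p ≡ prim n

label : ∀ {T} → Pos T → Maybe ℕ
label p with sub p
... | prim n = just n
... | _ ∖ _  = nothing
... | ! _    = nothing

data ArcLbl : Set where
  m1 p1 p2 : ArcLbl     -- -1, 1, 2

-- arcs: c ⟶ a  means O(c) = a (a is the parent of c)
data _⟶_ : ∀ {T} → Pos T → Pos T → Set where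
  arcL  : ∀ {A B} → inL {A} {B} here ⟶ here
  arcR  : ∀ {A B} → inR {A} {B} here ⟶ here
  arcB  : ∀ {A} → inBng {A} here ⟶ here
  deepL : ∀ {A B} {p q : Pos A} → p ⟶ q → inL {A} {B} p ⟶ inL q
  deepR : ∀ {A B} {p q : Pos B} → p ⟶ q → inR {A} {B} p ⟶ inR q
  deepB : ∀ {A} {p q : Pos A} → p ⟶ q → inBng p ⟶ inBng q

orA : ∀ {T} {c a : Pos T} → c ⟶ a → ArcLbl
orA arcL      = m1
orA arcR      = p1
orA arcB      = p2
orA (deepL e) = orA e
orA (deepR e) = orA e
orA (deepB e) = orA e

_O*_ : ∀ {T} → Pos T → Pos T → Set
_O*_ = Star _⟶_

data _≺_ : ∀ {T} → Pos T → Pos T → Set where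
  bRoot : ∀ {A} {p : Pos A} → here ≺ inBng p
  bIn   : ∀ {A} {p q : Pos A} → p ≺ q → inBng p ≺ inBng q
  -- A∖B : reversed A-part, then new root, then B-part
  lIn   : ∀ {A B} {p q : Pos A} → q ≺ p → inL {A} {B} p ≺ inL q
  lRoot : ∀ {A B} {p : Pos A} → inL {A} {B} p ≺ here
  lr    : ∀ {A B} {p : Pos A} {q : Pos B} → inL p ≺ inR q
  rRoot : ∀ {A B} {q : Pos B} → here ≺ inR {A} {B} q
  rIn   : ∀ {A B} {p q : Pos B} → p ≺ q → inR {A} {B} p ≺ inR q

-- d(a): number of arcs labelled -1 on the path from a to the root
dep : ∀ {T} → Pos T → ℕ
dep here      = 0
dep (inL p)   = suc (dep p)
dep (inR p)   = dep p
dep (inBng p) = dep p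

headPos : (T : Ty) → Pos T
headPos (prim n) = here
headPos (A ∖ B)  = inR (headPos B)
headPos (! A)    = inBng (headPos A)

-- H(a): unique leaf from which the path to a contains no arc labelled -1
H : ∀ {T} → Pos T → Pos T
H {T} here = headPos T
H (inL p)   = inL (H p)
H (inR p)   = inR (H p)
H (inBng p) = inBng (H p)

record IsProofNet {T : Ty} (U : Pos T → Set) (S : Pos T → Pos T → Set) : Set where
  field
    S⊆W×W : ∀ {a b : Pos T} → S a b → Leaf a × Leaf b
    PN1  : ∀ {a b : Pos T} → S a b → S b a
    PN2  : ∀ {a b c : Pos T} → S a b → S a c → b ≡ c
    PN3  : ∀ {a b c d : Pos T} → S a b → S c d → a ≺ c → c ≺ b → (a ≺ d) × (d ≺ b)
    PN4  : ∀ {a b : Pos T} → S a b → label a ≡ label b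
    PN5  : ∀ {a b : Pos T} → S a b → a ≺ b → dep a ≡ suc (dep b)
    PN6  : ∀ {a c b a' b' : Pos T} → a O* c → H c ≡ b → S a a' → S b b' →
           a ≺ b' → b' ≺ b → ∃ λ (d : Pos T) → (a' O* d) × (H d ≡ b)
    PN7  : ∃ λ (a : Pos T) → ∃ λ (b : Pos T) → S a b
    PN8⇒ : ∀ {a : Pos T} → (∃ λ (b : Pos T) → S a b) → Leaf a × U a
    PN8⇐ : ∀ {a : Pos T} → Leaf a → U a → ∃ λ (b : Pos T) → S a b
    PN9  : ∀ {a b : Pos T} → a ⟶ b → ¬ U b → ¬ U a
    PN10 : ∀ {a b : Pos T} → (e : a ⟶ b) → ¬ U a → ¬ (orA e ≡ p2) → ¬ U b
    PN11 : ∀ {a b : Pos T} → (e : a ⟶ b) → dep b % 2 ≡ 0 → ¬ (orA e ≡ p2)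

module Submission where

open import Defs
open import Data.List using (List)
open import Data.Nat using (zero; suc; _%_)
open import Data.Sum using (_⊎_; inj₁; inj₂)
open import Data.Product using (Σ; ∃; _×_; _,_)
open import Data.Empty using (⊥-elim)
open import Relation.Nullary using (¬_)
open import Relation.Binary.PropositionalEquality using (_≡_; refl; trans; sym; cong)
open import Relation.Binary.Construct.Closure.ReflexiveTransitive using (ε; _◅_; _◅◅_)

-- Only PN10 and PN11 matter.  By PN10, membership in U is inherited (up to double
-- negation) along arcs not labelled 2, so from a vertex of U one can walk down through
-- arcs labelled 1 and, once, -1 to a vertex of even depth, and from there through arcs
-- labelled 1 only.  This walk ends either at a leaf, which lies in U below a, or at a
-- vertex !A of even depth, whose arc labelled 2 is forbidden by PN11.  Hence a itself
-- must be a vertex !A, and its child is the required c.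

p1≢p2 : ¬ p1 ≡ p2
p1≢p2 ()

m1≢p2 : ¬ m1 ≡ p2
m1≢p2 ()

even⊎suc-even : ∀ n → n % 2 ≡ 0 ⊎ suc n % 2 ≡ 0
even⊎suc-even zero          = inj₁ refl
even⊎suc-even (suc zero)    = inj₂ refl
even⊎suc-even (suc (suc n)) = even⊎suc-even n

∖-right-child : ∀ {T} (a : Pos T) {A B} → sub a ≡ A ∖ B →
                ∃ λ (c : Pos T) → Σ (c ⟶ a) λ e → orA e ≡ p1 × sub c ≡ B × dep c ≡ dep a
∖-right-child here refl = inR here , arcR , refl , refl , refl
∖-right-child (inL p) s with ∖-right-child p s
... | c , e , o , t , d = inL c , deepL e , o , t , cong suc d
∖-right-child (inR p) s with ∖-right-child p s
... | c , e , o , t , d = inR c , deepR e , o , t , d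
∖-right-child (inBng p) s with ∖-right-child p s
... | c , e , o , t , d = inBng c , deepB e , o , t , d

∖-left-child : ∀ {T} (a : Pos T) {A B} → sub a ≡ A ∖ B →
               ∃ λ (c : Pos T) → Σ (c ⟶ a) λ e → orA e ≡ m1 × sub c ≡ A × dep c ≡ suc (dep a)
∖-left-child here refl = inL here , arcL , refl , refl , refl
∖-left-child (inL p) s with ∖-left-child p s
... | c , e , o , t , d = inL c , deepL e , o , t , cong suc d
∖-left-child (inR p) s with ∖-left-child p s
... | c , e , o , t , d = inR c , deepR e , o , t , d
∖-left-child (inBng p) s with ∖-left-child p s
... | c , e , o , t , d = inBng c , deepB e , o , t , d

!-child : ∀ {T} (a : Pos T) {A} → sub a ≡ ! A →
          ∃ λ (c : Pos T) → Σ (c ⟶ a) λ e → orA e ≡ p2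
!-child here refl = inBng here , arcB , refl
!-child (inL p) s with !-child p s
... | c , e , o = inL c , deepL e , o
!-child (inR p) s with !-child p s
... | c , e , o = inR c , deepR e , o
!-child (inBng p) s with !-child p s
... | c , e , o = inBng c , deepB e , o

∖-even-child : ∀ {T} (a : Pos T) {A B} → sub a ≡ A ∖ B →
               ∃ λ (c : Pos T) → Σ (c ⟶ a) λ e → ¬ orA e ≡ p2 × dep c % 2 ≡ 0
∖-even-child a s with even⊎suc-even (dep a)
... | inj₁ even with ∖-right-child a s
...   | c , e , o , _ , d = c , e , (λ q → p1≢p2 (trans (sym o) q)) , trans (cong (_% 2) d) even
∖-even-child a s | inj₂ even with ∖-left-child a s
...   | c , e , o , _ , d = c , e , (λ q → m1≢p2 (trans (sym o) q)) , trans (cong (_% 2) d) even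

module _ {T : Ty} (U : Pos T → Set)
         (pn10 : ∀ {a b : Pos T} → (e : a ⟶ b) → ¬ U a → ¬ (orA e ≡ p2) → ¬ U b)
         (pn11 : ∀ {a b : Pos T} → (e : a ⟶ b) → dep b % 2 ≡ 0 → ¬ (orA e ≡ p2)) where

  ULeafBelow : Pos T → Set
  ULeafBelow a = ∃ λ (b : Pos T) → U b × Leaf b × (b O* a)

  ULeafBelow-parent : ∀ {c a : Pos T} → c ⟶ a → ULeafBelow c → ULeafBelow a
  ULeafBelow-parent e (b , u , l , path) = b , u , l , (path ◅◅ (e ◅ ε))

  ¬¬U-child : ∀ {c a : Pos T} (e : c ⟶ a) → ¬ orA e ≡ p2 → ¬ ¬ U a → ¬ ¬ U c
  ¬¬U-child e ¬2 ¬¬u ¬u = ¬¬u (pn10 e ¬u ¬2)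

  even-¬¬U⇒¬¬ULeafBelow : (X : Ty) (a : Pos T) → sub a ≡ X → dep a % 2 ≡ 0 →
                          ¬ ¬ U a → ¬ ¬ ULeafBelow a
  even-¬¬U⇒¬¬ULeafBelow (prim n) a s _ ¬¬u ¬below = ¬¬u λ u → ¬below (a , u , (n , s) , ε)
  even-¬¬U⇒¬¬ULeafBelow (A ∖ B) a s even ¬¬u ¬below with ∖-right-child a s
  ... | c , e , o , t , d =
    even-¬¬U⇒¬¬ULeafBelow B c t (trans (cong (_% 2) d) even)
      (¬¬U-child e (λ q → p1≢p2 (trans (sym o) q)) ¬¬u)
      (λ below → ¬below (ULeafBelow-parent e below))
  even-¬¬U⇒¬¬ULeafBelow (! A) a s even _ _ with !-child a s
  ... | c , e , o = pn11 e even o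

  U-without-ULeafBelow-has-!-child : (a : Pos T) → U a → ¬ ULeafBelow a →
                                     ∃ λ (c : Pos T) → Σ (c ⟶ a) λ e → orA e ≡ p2
  U-without-ULeafBelow-has-!-child a u ¬below with sub a in s
  ... | prim n = ⊥-elim (¬below (a , u , (n , s) , ε))
  ... | ! A    = !-child a s
  ... | A ∖ B with ∖-even-child a s
  ...   | c , e , ¬2 , even =
    ⊥-elim (even-¬¬U⇒¬¬ULeafBelow (sub c) c refl even
              (¬¬U-child e ¬2 (λ ¬u → ¬u u))
              (λ below → ¬below (ULeafBelow-parent e below)))

lemma2p5 : (Γ : List Ty) (B : Ty)
           (U : Pos (seqTy Γ B) → Set) (S : Pos (seqTy Γ B) → Pos (seqTy Γ B) → Set) →
           IsProofNet U S →
           (a : Pos (seqTy Γ B)) → U a →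
           ¬ (∃ λ (b : Pos (seqTy Γ B)) → U b × Leaf b × (b O* a)) →
           ∃ λ (c : Pos (seqTy Γ B)) → Σ (c ⟶ a) λ e → orA e ≡ p2
lemma2p5 Γ B U S pn = U-without-ULeafBelow-has-!-child U PN10 PN11
  where open IsProofNet pn
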